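{- Let $\ell>0$ be an integer and let $G$ be a clique-triod in which each of the three attached paths has length $\ell$. Then $\rho(G)=\left\lceil \frac{\ell}{2}\right\rceil$.
   Context: Patrol game with radius of capture $\rho\ge 0$ on a connected graph $G$: there is one cop and one robber. Before the game the cop fixes a walk in $G$ (his patrol: a sequence of vertices in which consecutive vertices are equal or adjacent), and the robber knows the entire patrol in advance, while the cop has no information about the robber. The cop starts at the first vertex of his patrol, then the robber chooses a starting vertex; afterwards the players alternate moves (cop first), the cop following his patrol and the robber moving to an adjacent vertex or staying put. The cop wins if at some moment the distance between the cop and the robber is at most $\rho$; otherwise the robber wins. $\rho(G)$ is the minimum $\rho\ge0$ for which the cop has a patrol capturing the robber regardless of the robber's play. A clique-triod is a graph obtained from a clique on at least $3$ vertices (the clique-origin) and three vertex-disjoint paths, each attached by one endpoint to a different vertex of the clique-origin (and otherwise disjoint from it). Path length means number of edges. -}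

module Defs where

open import Data.Nat using (ℕ; zero; suc; _+_; _≤_; _<_)
open import Data.Fin using (Fin; toℕ)
open import Data.Product using (Σ; _×_; ∃; ∃-syntax)
open import Data.Sum using (_⊎_)
open import Relation.Binary.PropositionalEquality using (_≡_; _≢_)
open import Relation.Nullary using (¬_)

record Graph : Set₁ where
  field
    Vertex : Set
    Adj    : Vertex → Vertex → Set

module _ (G : Graph) where
  open Graph G

  Step : Vertex → Vertex → Set
  Step u v = (u ≡ v) ⊎ Adj u v

  -- Within n u v : there is a walk from u to v with at most n edges,
  -- i.e. dist(u , v) ≤ n.
  data Within : ℕ → Vertex → Vertex → Set where
    here : ∀ {u} → Within zero u u
    step : ∀ {n u w v} → Within n u w → Step w v → Within (suc n) u v

  -- A patrol: a finite walk c 0, c 1, ..., c T (values of c after T are irrelevant).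
  record Patrol : Set where
    field
      len   : ℕ
      pos   : ℕ → Vertex
      walk  : ∀ t → t < len → Step (pos t) (pos (suc t))

  record Robber : Set where
    field
      rpos  : ℕ → Vertex
      rwalk : ∀ t → Step (rpos t) (rpos (suc t))

  -- Game order: cop at c 0, robber picks r 0, cop moves to c 1, robber to r 1, ...
  -- Positions occurring: (c t , r t) for t ≤ T, and (c (t+1) , r t) for t < T.
  Captures : ℕ → Patrol → Robber → Set
  Captures ρ p r =
    (∃[ t ] (t ≤ Patrol.len p × Within ρ (Patrol.pos p t) (Robber.rpos r t)))
    ⊎ (∃[ t ] (t < Patrol.len p × Within ρ (Patrol.pos p (suc t)) (Robber.rpos r t)))

  CopWins : ℕ → Set
  CopWins ρ = Σ Patrol (λ p → ∀ (r : Robber) → Captures ρ p r)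

  RadiusIs : ℕ → Set
  RadiusIs k = CopWins k × (∀ ρ → ρ < k → ¬ CopWins ρ)

-- Vertices: clique vertices cl a, and path vertices pt i j (the (j+1)-th vertex
-- of path i, counted from the clique); path i is attached at clique vertex i.
data TriodV (m ℓ : ℕ) : Set where
  cl : Fin (3 + m) → TriodV m ℓ
  pt : Fin 3 → Fin ℓ → TriodV m ℓ

data TriodAdj {m ℓ : ℕ} : TriodV m ℓ → TriodV m ℓ → Set where
  cc  : ∀ {a b} → a ≢ b → TriodAdj (cl a) (cl b)
  cp  : ∀ {a i j} → toℕ a ≡ toℕ i → toℕ j ≡ 0 → TriodAdj (cl a) (pt i j)
  pc  : ∀ {a i j} → toℕ a ≡ toℕ i → toℕ j ≡ 0 → TriodAdj (pt i j) (cl a)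
  pp  : ∀ {i j j'} → toℕ j' ≡ suc (toℕ j) → TriodAdj (pt i j) (pt i j')
  pp' : ∀ {i j j'} → toℕ j ≡ suc (toℕ j') → TriodAdj (pt i j) (pt i j')

CliqueTriod : ℕ → ℕ → Graph
CliqueTriod m ℓ = record { Vertex = TriodV m ℓ ; Adj = TriodAdj }

-- A vertex is described by its root (the clique vertex it hangs from) and its depth; the
-- distance is |depth u − depth v| between vertices with the same root and
-- depth u + depth v + 1 otherwise.
--
-- Cop: with h = ⌊ℓ/2⌋ and k = ⌈ℓ/2⌉ the cop sweeps the paths 0, 1, 2 up to depth h, crossing
-- the clique in between.  From depth h of a path he is within k of all of it, and every move
-- has an endpoint shallower than k, so a robber who is ever in the clique, in particular one
-- who changes paths, is caught; otherwise he is caught when his path is swept.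
--
-- Robber: for ρ < k we have 2ρ + 1 ≤ ℓ.  Call the cop deep when his depth exceeds ρ.  The robber
-- stays on a path different from those of the cop's last and next deep positions, at depth
-- d = min(ℓ, time since the last deep position, time until the next one).  At depth ℓ he is out
-- of reach of a cop who is not deep.  Otherwise d is the time to a deep position on another
-- path, which is at distance at least ρ + 2 + d from him; at the two moments his position is
-- checked the cop is at most d + 1 steps of walking away from it, hence farther than ρ.

module Submission where

open import Defs
open import Data.Nat
open import Data.Nat.Properties
open import Data.Nat.DivMod using (_mod_; m<n⇒m%n≡m)
open import Data.Fin as Fin using (Fin; toℕ; _↑ˡ_)
open import Data.Fin.Patterns using (0F; 1F; 2F)
open import Data.Fin.Properties using (toℕ-injective; toℕ-↑ˡ; toℕ-fromℕ<; toℕ<n)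
open import Data.Product using (Σ-syntax; ∃-syntax; _×_; _,_; proj₁; proj₂)
open import Data.Sum using (_⊎_; inj₁; inj₂; [_,_]′; swap)
open import Data.Empty using (⊥-elim)
open import Level using (0ℓ)
open import Relation.Binary.Core using (Rel)
open import Relation.Binary.Construct.Closure.ReflexiveTransitive using (Star; ε; _◅_; _◅◅_; reverse)
open import Relation.Binary.PropositionalEquality
open import Relation.Nullary using (¬_; Dec; yes; no)
open import Relation.Nullary.Decidable using (toSum)

∸-suc : ∀ {n t} → t < n → n ∸ t ≡ suc (n ∸ suc t)
∸-suc t<n = +-∸-assoc 1 t<n

∣n-1+n∣≡1 : ∀ n → ∣ n - suc n ∣ ≡ 1
∣n-1+n∣≡1 zero = refl
∣n-1+n∣≡1 (suc n) = ∣n-1+n∣≡1 n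

∣m-n∣≤1 : ∀ {m n} → m ≤ suc n → n ≤ suc m → ∣ m - n ∣ ≤ 1
∣m-n∣≤1 {zero} {n} _ n≤1 = n≤1
∣m-n∣≤1 {suc m} {zero} m≤1 _ = m≤1
∣m-n∣≤1 {suc m} {suc n} (s≤s m≤1+n) (s≤s n≤1+m) = ∣m-n∣≤1 m≤1+n n≤1+m

∣m-n∣≤1⇒n≤1+m : ∀ m n → ∣ m - n ∣ ≤ 1 → n ≤ suc m
∣m-n∣≤1⇒n≤1+m m n close = begin
  n               ≤⟨ m≤n+m∸n n m ⟩
  m + (n ∸ m)     ≤⟨ +-monoʳ-≤ m (≤-trans (m∸n≤∣m-n∣ n m) (≤-trans (≤-reflexive (∣-∣-comm n m)) close)) ⟩
  m + 1           ≡⟨ +-comm m 1 ⟩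
  suc m           ∎
  where open ≤-Reasoning

∣m-n∣≤1-cases : ∀ m n → ∣ m - n ∣ ≤ 1 → m ≡ n ⊎ n ≡ suc m ⊎ m ≡ suc n
∣m-n∣≤1-cases zero zero _ = inj₁ refl
∣m-n∣≤1-cases zero (suc zero) _ = inj₂ (inj₁ refl)
∣m-n∣≤1-cases (suc zero) zero _ = inj₂ (inj₂ refl)
∣m-n∣≤1-cases zero (suc (suc n)) (s≤s ())
∣m-n∣≤1-cases (suc (suc m)) zero (s≤s ())
∣m-n∣≤1-cases (suc m) (suc n) close with ∣m-n∣≤1-cases m n close
... | inj₁ eq = inj₁ (cong suc eq)
... | inj₂ (inj₁ eq) = inj₂ (inj₁ (cong suc eq))
... | inj₂ (inj₂ eq) = inj₂ (inj₂ (cong suc eq))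

⊓-cases₃ : ∀ l a b → (l ⊓ a ⊓ b ≡ l × l ≤ a × l ≤ b) ⊎ (l ⊓ a ⊓ b ≡ a × a < l) ⊎ (l ⊓ a ⊓ b ≡ b × b < l)
⊓-cases₃ l a b with ≤-<-connex l a
... | inj₁ l≤a with ≤-<-connex l b
...   | inj₁ l≤b = inj₁ (trans (cong (_⊓ b) (m≤n⇒m⊓n≡m l≤a)) (m≤n⇒m⊓n≡m l≤b) , l≤a , l≤b)
...   | inj₂ b<l = inj₂ (inj₂ (trans (cong (_⊓ b) (m≤n⇒m⊓n≡m l≤a)) (m≥n⇒m⊓n≡n (<⇒≤ b<l)) , b<l))
⊓-cases₃ l a b | inj₂ a<l with ≤-<-connex a b
...   | inj₁ a≤b = inj₂ (inj₁ (trans (cong (_⊓ b) (m≥n⇒m⊓n≡n (<⇒≤ a<l))) (m≤n⇒m⊓n≡m a≤b) , a<l))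
...   | inj₂ b<a = inj₂ (inj₂ (trans (cong (_⊓ b) (m≥n⇒m⊓n≡n (<⇒≤ a<l))) (m≥n⇒m⊓n≡n (<⇒≤ b<a)) , <-trans b<a a<l))

∣l⊓a⊓1+b-l⊓1+a⊓b∣≤1 : ∀ l a b → ∣ l ⊓ a ⊓ suc b - l ⊓ suc a ⊓ b ∣ ≤ 1
∣l⊓a⊓1+b-l⊓1+a⊓b∣≤1 l a b = ∣m-n∣≤1
  (⊓-mono-≤ (⊓-mono-≤ (n≤1+n l) (m≤n⇒m≤1+n (n≤1+n a))) ≤-refl)
  (⊓-mono-≤ (⊓-mono-≤ (n≤1+n l) ≤-refl) (m≤n⇒m≤1+n (n≤1+n b)))

∣⌊n/2⌋-m∣≤⌈n/2⌉ : ∀ {m n} → m ≤ n → ∣ ⌊ n /2⌋ - m ∣ ≤ ⌈ n /2⌉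
∣⌊n/2⌋-m∣≤⌈n/2⌉ {m} {n} m≤n with ≤-total ⌊ n /2⌋ m
... | inj₁ h≤m = begin
  ∣ ⌊ n /2⌋ - m ∣        ≡⟨ m≤n⇒∣m-n∣≡n∸m h≤m ⟩
  m ∸ ⌊ n /2⌋            ≤⟨ ∸-monoˡ-≤ ⌊ n /2⌋ m≤n ⟩
  n ∸ ⌊ n /2⌋            ≡⟨ cong (_∸ ⌊ n /2⌋) (sym (⌊n/2⌋+⌈n/2⌉≡n n)) ⟩
  ⌊ n /2⌋ + ⌈ n /2⌉ ∸ ⌊ n /2⌋ ≡⟨ m+n∸m≡n ⌊ n /2⌋ ⌈ n /2⌉ ⟩
  ⌈ n /2⌉                ∎
  where open ≤-Reasoning
... | inj₂ m≤h = begin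
  ∣ ⌊ n /2⌋ - m ∣        ≡⟨ m≤n⇒∣n-m∣≡n∸m m≤h ⟩
  ⌊ n /2⌋ ∸ m            ≤⟨ m∸n≤m ⌊ n /2⌋ m ⟩
  ⌊ n /2⌋                ≤⟨ ⌊n/2⌋≤⌈n/2⌉ n ⟩
  ⌈ n /2⌉                ∎
  where open ≤-Reasoning

m<⌈n/2⌉⇒m+[1+m]≤n : ∀ {m n} → m < ⌈ n /2⌉ → m + suc m ≤ n
m<⌈n/2⌉⇒m+[1+m]≤n {m} {n} m<k = begin
  m + suc m              ≤⟨ +-mono-≤ m≤h m<k ⟩
  ⌊ n /2⌋ + ⌈ n /2⌉      ≡⟨ ⌊n/2⌋+⌈n/2⌉≡n n ⟩
  n                      ∎
  where
  open ≤-Reasoning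
  m≤h : m ≤ ⌊ n /2⌋
  m≤h = ≤-pred (≤-trans m<k (⌊n/2⌋-mono (n≤1+n (suc n))))

module _ (G : Graph) where
  open Graph G

  step-refl : ∀ {u} → Step G u u
  step-refl = inj₁ refl

  within-≤ : ∀ {m n u v} → m ≤ n → Within G m u v → Within G n u v
  within-≤ m≤n = go (≤⇒≤′ m≤n)
    where
    go : ∀ {m n u v} → m ≤′ n → Within G m u v → Within G n u v
    go ≤′-refl w = w
    go (≤′-step m≤′n) w = step (go m≤′n w) step-refl

  within-trans : ∀ {m n u v w} → Within G m u v → Within G n v w → Within G (n + m) u w
  within-trans p here = p
  within-trans p (step q s) = step (within-trans p q) s

  _◃_ : ∀ {n u v w} → Step G u v → Within G n v w → Within G (suc n) u w
  s ◃ here = step here s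
  s ◃ step p s′ = step (s ◃ p) s′

  within-lipschitz : (f : Vertex → ℕ) → (∀ {v w} → Step G v w → f w ≤ suc (f v)) →
                     ∀ {n v w} → Within G n v w → f w ≤ n + f v
  within-lipschitz f lip here = ≤-refl
  within-lipschitz f lip (step p s) = ≤-trans (lip s) (s≤s (within-lipschitz f lip p))

  module _ (adj-sym : ∀ {u v} → Adj u v → Adj v u) where

    step-sym : ∀ {u v} → Step G u v → Step G v u
    step-sym (inj₁ refl) = step-refl
    step-sym (inj₂ a) = inj₂ (adj-sym a)

    within-sym : ∀ {n u v} → Within G n u v → Within G n v u
    within-sym here = here
    within-sym (step p s) = step-sym s ◃ within-sym p

  module _ (p : Patrol G) where
    open Patrol p

    patrol-within : ∀ {s t} → s ≤ t → t ≤ len → Within G (t ∸ s) (pos s) (pos t)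
    patrol-within {s} {t} s≤t t≤len =
      subst (λ t → Within G (t ∸ s) (pos s) (pos t)) (m∸n+n≡m s≤t)
        (subst (λ n → Within G n (pos s) (pos (t ∸ s + s))) (sym (m+n∸n≡m (t ∸ s) s))
          (forward (t ∸ s) (≤-trans (≤-reflexive (m∸n+n≡m s≤t)) t≤len)))
      where
      forward : ∀ n → n + s ≤ len → Within G n (pos s) (pos (n + s))
      forward zero _ = here
      forward (suc n) n+s<len = step (forward n (<⇒≤ n+s<len)) (walk (n + s) n+s<len)

  haltAt : (T : ℕ) (f : ℕ → Vertex) → (∀ t → t < T → Step G (f t) (f (suc t))) → Robber G
  haltAt T f f-walk = record { rpos = λ t → f (t ⊓ T) ; rwalk = rwalk }
    where
    rwalk : ∀ t → Step G (f (t ⊓ T)) (f (suc t ⊓ T))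
    rwalk t with t <? T
    ... | yes t<T rewrite m≤n⇒m⊓n≡m (<⇒≤ t<T) | m≤n⇒m⊓n≡m t<T = f-walk t t<T
    ... | no t≮T rewrite m≥n⇒m⊓n≡n (≮⇒≥ t≮T) | m≥n⇒m⊓n≡n (m≤n⇒m≤1+n (≮⇒≥ t≮T)) = step-refl

  haltAt-rpos : ∀ T f f-walk {t} → t ≤ T → Robber.rpos (haltAt T f f-walk) t ≡ f t
  haltAt-rpos T f f-walk t≤T = cong f (m≤n⇒m⊓n≡m t≤T)

  module _ {R : Rel Vertex 0ℓ} where

    steps : ∀ {u v} → Star R u v → ℕ
    steps ε = 0
    steps (_ ◅ w) = suc (steps w)

    at : ∀ {u v} → Star R u v → ℕ → Vertex
    at {u} ε _ = u
    at {u} (_ ◅ _) zero = u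
    at (_ ◅ w) (suc t) = at w t

    at-zero : ∀ {u v} (w : Star R u v) → at w 0 ≡ u
    at-zero ε = refl
    at-zero (_ ◅ _) = refl

    at-steps : ∀ {u v} (w : Star R u v) → at w (steps w) ≡ v
    at-steps ε = refl
    at-steps (_ ◅ w) = at-steps w

    at-◅◅ : ∀ {u v x} (w₁ : Star R u v) (w₂ : Star R v x) → at (w₁ ◅◅ w₂) (steps w₁) ≡ v
    at-◅◅ ε w₂ = at-zero w₂
    at-◅◅ (_ ◅ w₁) w₂ = at-◅◅ w₁ w₂

    steps-◅◅ : ∀ {u v x} (w₁ : Star R u v) (w₂ : Star R v x) → steps (w₁ ◅◅ w₂) ≡ steps w₁ + steps w₂
    steps-◅◅ ε w₂ = refl
    steps-◅◅ (_ ◅ w₁) w₂ = cong suc (steps-◅◅ w₁ w₂)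

    0<steps-◅◅-◅ : ∀ {u v x y} (w₁ : Star R u v) (r : R v x) (w₂ : Star R x y) → 0 < steps (w₁ ◅◅ r ◅ w₂)
    0<steps-◅◅-◅ ε _ _ = s≤s z≤n
    0<steps-◅◅-◅ (_ ◅ _) _ _ = s≤s z≤n

    at-step : ∀ {u v t} (w : Star R u v) → t < steps w → R (at w t) (at w (suc t))
    at-step {t = zero} (r ◅ w) _ = subst (R _) (sym (at-zero w)) r
    at-step {t = suc t} (_ ◅ w) (s≤s t<n) = at-step w t<n

    toPatrol : (∀ {u v} → R u v → Step G u v) → ∀ {u v} → Star R u v → Patrol G
    toPatrol R⇒Step w = record { len = steps w ; pos = at w ; walk = λ t t<n → R⇒Step (at-step w t<n) }

-- The clique-triod with paths of length ℓ = 1 + ℓ′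

module Geometry (m ℓ′ : ℕ) where

  ℓ : ℕ
  ℓ = suc ℓ′

  Triod : Graph
  Triod = CliqueTriod m ℓ

  V : Set
  V = TriodV m ℓ

  root : V → ℕ
  root (cl a) = toℕ a
  root (pt i j) = toℕ i

  depth : V → ℕ
  depth (cl a) = 0
  depth (pt i j) = suc (toℕ j)

  depth≤ℓ : ∀ v → depth v ≤ ℓ
  depth≤ℓ (cl a) = z≤n
  depth≤ℓ (pt i j) = toℕ<n j

  -- Depths beyond ℓ wrap around.
  onPath : Fin 3 → ℕ → V
  onPath i zero = cl (i ↑ˡ m)
  onPath i (suc d) = pt i (d mod ℓ)

  toℕ-mod : ∀ {d} → d < ℓ → toℕ (d mod ℓ) ≡ d
  toℕ-mod d<ℓ = trans (toℕ-fromℕ< _) (m<n⇒m%n≡m d<ℓ)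

  root-onPath : ∀ i d → root (onPath i d) ≡ toℕ i
  root-onPath i zero = toℕ-↑ˡ i m
  root-onPath i (suc d) = refl

  depth-onPath : ∀ i {d} → d ≤ ℓ → depth (onPath i d) ≡ d
  depth-onPath i {zero} _ = refl
  depth-onPath i {suc d} d<ℓ = cong suc (toℕ-mod d<ℓ)

  onPath-depth : ∀ i v → root v ≡ toℕ i → onPath i (depth v) ≡ v
  onPath-depth i (cl a) eq = cong cl (toℕ-injective (trans (toℕ-↑ˡ i m) (sym eq)))
  onPath-depth i (pt i′ j) eq = cong₂ pt (toℕ-injective (sym eq)) (toℕ-injective (toℕ-mod (toℕ<n j)))

  adj-sym : ∀ {u v : V} → TriodAdj u v → TriodAdj v u
  adj-sym (cc a≢b) = cc (λ eq → a≢b (sym eq))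
  adj-sym (cp a≡i j≡0) = pc a≡i j≡0
  adj-sym (pc a≡i j≡0) = cp a≡i j≡0
  adj-sym (pp e) = pp' e
  adj-sym (pp' e) = pp e

  clique-step : ∀ a b → Step Triod (cl a) (cl b)
  clique-step a b with a Fin.≟ b
  ... | yes a≡b = inj₁ (cong cl a≡b)
  ... | no a≢b = inj₂ (cc a≢b)

  onPath-up : ∀ i {d} → suc d ≤ ℓ → Step Triod (onPath i d) (onPath i (suc d))
  onPath-up i {zero} _ = inj₂ (cp (toℕ-↑ˡ i m) (toℕ-mod {0} (s≤s z≤n)))
  onPath-up i {suc d} d+1<ℓ = inj₂ (pp (trans (toℕ-mod d+1<ℓ) (cong suc (sym (toℕ-mod (<⇒≤ d+1<ℓ))))))

  onPath-step : ∀ i {d e} → d ≤ ℓ → e ≤ ℓ → ∣ d - e ∣ ≤ 1 → Step Triod (onPath i d) (onPath i e)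
  onPath-step i {d} {e} d≤ℓ e≤ℓ close with ∣m-n∣≤1-cases d e close
  ... | inj₁ refl = step-refl Triod
  ... | inj₂ (inj₁ refl) = onPath-up i e≤ℓ
  ... | inj₂ (inj₂ refl) = step-sym Triod adj-sym (onPath-up i d≤ℓ)

  dist : V → V → ℕ
  dist u v with root u ≟ root v
  ... | yes _ = ∣ depth u - depth v ∣
  ... | no _ = suc (depth u + depth v)

  dist-self : ∀ u → dist u u ≡ 0
  dist-self u with root u ≟ root u
  ... | yes _ = ∣n-n∣≡0 (depth u)
  ... | no r≢r = ⊥-elim (r≢r refl)

  dist-same-root : ∀ {u v} → root u ≡ root v → dist u v ≡ ∣ depth u - depth v ∣
  dist-same-root {u} {v} same with root u ≟ root v
  ... | yes _ = refl
  ... | no differ = ⊥-elim (differ same)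

  dist-other-root : ∀ {u v} → root u ≢ root v → dist u v ≡ suc (depth u + depth v)
  dist-other-root {u} {v} differ with root u ≟ root v
  ... | yes same = ⊥-elim (differ same)
  ... | no _ = refl

  dist≤1+depth+depth : ∀ u v → dist u v ≤ suc (depth u + depth v)
  dist≤1+depth+depth u v with root u ≟ root v
  ... | yes _ = ≤-trans (∣m-n∣≤m⊔n (depth u) (depth v)) (≤-trans (m⊔n≤m+n (depth u) (depth v)) (n≤1+n _))
  ... | no _ = ≤-refl

  depth∸depth≤dist : ∀ u v → depth v ∸ depth u ≤ dist u v
  depth∸depth≤dist u v with root u ≟ root v
  ... | yes _ = ≤-trans (m∸n≤∣m-n∣ (depth v) (depth u)) (≤-reflexive (∣-∣-comm (depth v) (depth u)))
  ... | no _ = ≤-trans (m∸n≤m (depth v) (depth u)) (≤-trans (m≤n+m (depth v) (depth u)) (n≤1+n _))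

  Near : V → V → Set
  Near u v = (root u ≡ root v × ∣ depth u - depth v ∣ ≤ 1) ⊎ (depth u ≡ 0 × depth v ≡ 0)

  step-near : ∀ {u v} → Step Triod u v → Near u v
  step-near {u} (inj₁ refl) = inj₁ (refl , ≤-trans (≤-reflexive (∣n-n∣≡0 (depth u))) z≤n)
  step-near (inj₂ (cc _)) = inj₂ (refl , refl)
  step-near (inj₂ (cp a≡i j≡0)) = inj₁ (a≡i , s≤s (≤-reflexive j≡0))
  step-near (inj₂ (pc a≡i j≡0)) = inj₁ (sym a≡i , s≤s (≤-reflexive j≡0))
  step-near (inj₂ (pp {j = j} e)) = inj₁ (refl , ≤-reflexive (subst (λ x → ∣ toℕ j - x ∣ ≡ 1) (sym e) (∣n-1+n∣≡1 (toℕ j))))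
  step-near (inj₂ (pp' {j' = j′} e)) = inj₁ (refl , ≤-reflexive (subst (λ x → ∣ x - toℕ j′ ∣ ≡ 1) (sym e)
                                          (trans (∣-∣-comm (suc (toℕ j′)) (toℕ j′)) (∣n-1+n∣≡1 (toℕ j′)))))

  dist-lipschitz : ∀ x {u u′} → Near u u′ → dist u′ x ≤ suc (dist u x)
  dist-lipschitz x {u} {u′} (inj₁ (same , close)) with root u ≟ root x | root u′ ≟ root x
  ... | yes _ | yes _ = ≤-trans (∣-∣-triangle (depth u′) (depth u) (depth x))
                          (+-monoˡ-≤ ∣ depth u - depth x ∣ (≤-trans (≤-reflexive (∣-∣-comm (depth u′) (depth u))) close))
  ... | yes u~x | no u′≁x = ⊥-elim (u′≁x (trans (sym same) u~x))
  ... | no u≁x | yes u′~x = ⊥-elim (u≁x (trans same u′~x))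
  ... | no _ | no _ = s≤s (+-monoˡ-≤ (depth x) (∣m-n∣≤1⇒n≤1+m (depth u) (depth u′) close))
  dist-lipschitz x {u} {u′} (inj₂ (u≡0 , u′≡0)) = begin
    dist u′ x                  ≤⟨ dist≤1+depth+depth u′ x ⟩
    suc (depth u′ + depth x)   ≡⟨ cong (λ d → suc (d + depth x)) u′≡0 ⟩
    suc (depth x)              ≡⟨ cong (λ d → suc (depth x ∸ d)) (sym u≡0) ⟩
    suc (depth x ∸ depth u)    ≤⟨ s≤s (depth∸depth≤dist u x) ⟩
    suc (dist u x)             ∎
    where open ≤-Reasoning

  dist-triangle : ∀ x {n u w} → Within Triod n u w → dist w x ≤ n + dist u x
  dist-triangle x = within-lipschitz Triod (λ y → dist y x) (λ s → dist-lipschitz x (step-near s))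

  within⇒dist≤ : ∀ {n u v} → Within Triod n u v → dist u v ≤ n
  within⇒dist≤ {n} {u} {v} w = begin
    dist u v       ≤⟨ dist-triangle v (within-sym Triod adj-sym w) ⟩
    n + dist v v   ≡⟨ cong (n +_) (dist-self v) ⟩
    n + 0          ≡⟨ +-identityʳ n ⟩
    n              ∎
    where open ≤-Reasoning

  along : ∀ i {d e} → d ≤ e → e ≤ ℓ → Within Triod (e ∸ d) (onPath i d) (onPath i e)
  along i {d} {e} d≤e e≤ℓ =
    subst (λ x → Within Triod (e ∸ d) (onPath i d) (onPath i x)) (m∸n+n≡m d≤e)
      (ascend (e ∸ d) (≤-trans (≤-reflexive (m∸n+n≡m d≤e)) e≤ℓ))
    where
    ascend : ∀ n → n + d ≤ ℓ → Within Triod n (onPath i d) (onPath i (n + d))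
    ascend zero _ = here
    ascend (suc n) n+d<ℓ = step (ascend n (<⇒≤ n+d<ℓ)) (onPath-up i n+d<ℓ)

  along-between : ∀ i {d e} → d ≤ ℓ → e ≤ ℓ → Within Triod ∣ d - e ∣ (onPath i d) (onPath i e)
  along-between i {d} {e} d≤ℓ e≤ℓ with ≤-total d e
  ... | inj₁ d≤e = subst (λ n → Within Triod n _ _) (sym (m≤n⇒∣m-n∣≡n∸m d≤e)) (along i d≤e e≤ℓ)
  ... | inj₂ e≤d = subst (λ n → Within Triod n _ _) (sym (m≤n⇒∣n-m∣≡n∸m e≤d))
                     (within-sym Triod adj-sym (along i e≤d d≤ℓ))

  within-same-root : ∀ i u v → root u ≡ toℕ i → root v ≡ toℕ i → Within Triod ∣ depth u - depth v ∣ u v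
  within-same-root i u v u-on-i v-on-i =
    subst₂ (Within Triod _) (onPath-depth i u u-on-i) (onPath-depth i v v-on-i)
      (along-between i (depth≤ℓ u) (depth≤ℓ v))

  hub : V → Fin (3 + m)
  hub (cl a) = a
  hub (pt i j) = i ↑ˡ m

  to-hub : ∀ u → Within Triod (depth u) u (cl (hub u))
  to-hub (cl a) = here
  to-hub (pt i j) = within-same-root i (pt i j) (cl (i ↑ˡ m)) refl (toℕ-↑ˡ i m)

  within-dist : ∀ u v → Within Triod (dist u v) u v
  within-dist u v with root u ≟ root v
  within-dist (cl a) (cl b) | yes same = subst (λ b → Within Triod 0 (cl a) (cl b)) (toℕ-injective same) here
  within-dist u (pt i j) | yes same = within-same-root i u (pt i j) same refl
  within-dist (pt i j) v | yes same = within-same-root i (pt i j) v refl (sym same)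
  ... | no _ = within-≤ Triod (≤-reflexive (trans (+-suc (depth v) (depth u)) (cong suc (+-comm (depth v) (depth u)))))
                 (within-trans Triod (step (to-hub u) (clique-step (hub u) (hub v))) (within-sym Triod adj-sym (to-hub v)))

  dist-to-clique : ∀ u {v} → depth v ≡ 0 → dist u v ≤ suc (depth u)
  dist-to-clique u {v} v≡0 = ≤-trans (dist≤1+depth+depth u v)
    (≤-reflexive (cong suc (trans (cong (depth u +_) v≡0) (+-identityʳ (depth u)))))

  dist-onPath : ∀ i {d v} → d ≤ ℓ → root v ≡ toℕ i → dist (onPath i d) v ≡ ∣ d - depth v ∣
  dist-onPath i {d} {v} d≤ℓ v-on-i =
    trans (dist-same-root {onPath i d} {v} (trans (root-onPath i d) (sym v-on-i))) (cong (∣_- _ ∣) (depth-onPath i d≤ℓ))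

  far-from-deep : ∀ {ρ n u w} x → Within Triod n u w → ρ < depth w → root w ≢ root x →
                  n ≤ suc (depth x) → ρ < dist u x
  far-from-deep {ρ} {n} {u} {w} x walk deep differ n≤1+d = +-cancelʳ-≤ (suc (depth x)) (suc ρ) (dist u x) (begin
    suc ρ + suc (depth x)     ≡⟨ +-suc (suc ρ) (depth x) ⟩
    suc (suc ρ + depth x)     ≤⟨ s≤s (+-monoˡ-≤ (depth x) deep) ⟩
    suc (depth w + depth x)   ≡⟨ sym (dist-other-root {w} {x} differ) ⟩
    dist w x                  ≤⟨ dist-triangle x walk ⟩
    n + dist u x              ≤⟨ +-monoˡ-≤ (dist u x) n≤1+d ⟩
    suc (depth x) + dist u x  ≡⟨ +-comm (suc (depth x)) (dist u x) ⟩
    dist u x + suc (depth x)  ∎)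
    where open ≤-Reasoning

  leaf-far : ∀ {ρ u x} → ρ + suc ρ ≤ ℓ → depth u ≤ ρ → depth x ≡ ℓ → ρ < dist u x
  leaf-far {ρ} {u} {x} room shallow leaf = begin
    suc ρ              ≤⟨ m+n≤o⇒m≤o∸n (suc ρ) (subst (_≤ ℓ) (+-comm ρ (suc ρ)) room) ⟩
    ℓ ∸ ρ              ≤⟨ ∸-monoʳ-≤ ℓ shallow ⟩
    ℓ ∸ depth u        ≡⟨ cong (_∸ depth u) (sym leaf) ⟩
    depth x ∸ depth u  ≤⟨ depth∸depth≤dist u x ⟩
    dist u x           ∎
    where open ≤-Reasoning

-- The cop wins with radius ⌈ ℓ/2 ⌉

module UpperBound (m ℓ′ : ℕ) where
  open Geometry m ℓ′

  k h : ℕ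
  k = ⌈ ℓ /2⌉
  h = ⌊ ℓ /2⌋

  h≤k : h ≤ k
  h≤k = ⌊n/2⌋≤⌈n/2⌉ ℓ

  h≤ℓ : h ≤ ℓ
  h≤ℓ = ⌊n/2⌋≤n ℓ

  Move : Rel V 0ℓ
  Move u v = Step Triod u v × (depth u < k ⊎ depth v < k)

  move-sym : ∀ {u v} → Move u v → Move v u
  move-sym (s , shallow) = step-sym Triod adj-sym s , swap shallow

  descend : ∀ i d → d ≤ h → Star Move (onPath i d) (onPath i 0)
  descend i zero _ = ε
  descend i (suc d) d<h = (step-sym Triod adj-sym (onPath-up i (≤-trans d<h h≤ℓ)) , inj₂ d<k) ◅ descend i d (<⇒≤ d<h)
    where
    d<k : depth (onPath i d) < k
    d<k = ≤-trans (s≤s (≤-reflexive (depth-onPath i (<⇒≤ (≤-trans d<h h≤ℓ))))) (≤-trans d<h h≤k)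

  hop : ∀ i j → Move (onPath i 0) (onPath j 0)
  hop i j = clique-step _ _ , inj₁ (s≤s z≤n)

  leg : ∀ i j → Star Move (onPath i h) (onPath j h)
  leg i j = descend i h ≤-refl ◅◅ hop i j ◅ reverse move-sym (descend j h ≤-refl)

  sweep : Star Move (onPath 0F h) (onPath 2F h)
  sweep = leg 0F 1F ◅◅ leg 1F 2F

  patrol : Patrol Triod
  patrol = toPatrol Triod proj₁ sweep

  open Patrol patrol

  first-leg≤len : steps Triod (leg 0F 1F) ≤ len
  first-leg≤len = ≤-trans (m≤m+n _ _) (≤-reflexive (sym (steps-◅◅ Triod (leg 0F 1F) (leg 1F 2F))))

  0<len : 0 < len
  0<len = ≤-trans (0<steps-◅◅-◅ Triod (descend 0F h ≤-refl) (hop 0F 1F) _) first-leg≤len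

  visits : ∀ i → ∃[ t ] (t ≤ len × pos t ≡ onPath i h)
  visits 0F = 0 , z≤n , at-zero Triod sweep
  visits 1F = steps Triod (leg 0F 1F) , first-leg≤len , at-◅◅ Triod (leg 0F 1F) (leg 1F 2F)
  visits 2F = len , ≤-refl , at-steps Triod sweep

  within-k-of-clique : ∀ {c v} → depth v ≡ 0 → depth c < k → Within Triod k c v
  within-k-of-clique {c} {v} v≡0 shallow = within-≤ Triod (≤-trans (dist-to-clique c v≡0) shallow) (within-dist c v)

  module _ (r : Robber Triod) where
    open Robber r

    Caught : Set
    Caught = Captures Triod k patrol r

    caught-in-clique : ∀ {t} → t < len → depth (rpos t) ≡ 0 → Caught
    caught-in-clique {t} t<len at-clique with proj₂ (at-step Triod sweep t<len)
    ... | inj₁ shallow = inj₁ (t , <⇒≤ t<len , within-k-of-clique at-clique shallow)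
    ... | inj₂ shallow = inj₂ (t , t<len , within-k-of-clique at-clique shallow)

    root-stable : ∀ t → t ≤ len → Caught ⊎ root (rpos t) ≡ root (rpos 0)
    root-stable zero _ = inj₂ refl
    root-stable (suc t) t<len with root-stable t (<⇒≤ t<len) | step-near (rwalk t)
    ... | inj₁ caught | _ = inj₁ caught
    ... | inj₂ same | inj₁ (stay , _) = inj₂ (trans (sym stay) same)
    ... | inj₂ _ | inj₂ (at-clique , _) = inj₁ (caught-in-clique t<len at-clique)

    caught-on-path : ∀ i → root (rpos 0) ≡ toℕ i → Caught
    caught-on-path i start-on-i with visits i
    ... | t , t≤len , pos-t with root-stable t t≤len
    ...   | inj₁ caught = caught
    ...   | inj₂ same = inj₁ (t , t≤len , subst (λ c → Within Triod k c (rpos t)) (sym pos-t)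
                                             (within-≤ Triod close (within-dist (onPath i h) (rpos t))))
      where
      close : dist (onPath i h) (rpos t) ≤ k
      close = ≤-trans (≤-reflexive (dist-onPath i h≤ℓ (trans same start-on-i))) (∣⌊n/2⌋-m∣≤⌈n/2⌉ (depth≤ℓ (rpos t)))

    caught : Caught
    caught with rpos 0 in start
    ... | cl a = caught-in-clique 0<len (cong depth start)
    ... | pt i j = caught-on-path i (cong root start)

  copWins : CopWins Triod k
  copWins = patrol , caught

-- The robber escapes every patrol when ρ < ⌈ ℓ/2 ⌉

avoid : (a b : ℕ) → Σ[ z ∈ Fin 3 ] (toℕ z ≢ a × toℕ z ≢ b)
avoid a b with 0 ≟ a | 0 ≟ b
... | no 0≢a | no 0≢b = 0F , 0≢a , 0≢b
... | yes refl | _ with 1 ≟ b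
...   | no 1≢b = 1F , (λ ()) , 1≢b
...   | yes refl = 2F , (λ ()) , (λ ())
avoid a b | no _ | yes refl with 1 ≟ a
...   | no 1≢a = 1F , 1≢a , (λ ())
...   | yes refl = 2F , (λ ()) , (λ ())

module LowerBound (m ℓ′ : ℕ) where
  open Geometry m ℓ′

  module Evasion (ρ : ℕ) (room : ρ + suc ρ ≤ ℓ) (p : Patrol Triod) where
    open Patrol p

    Deep : ℕ → Set
    Deep t = ρ < depth (pos t)

    deep? : ∀ t → Dec (Deep t)
    deep? t = ρ <? depth (pos t)

    -- lastDeep t: the cop was last deep at time t ∸ gap; nextDeep t: he is next deep at time
    -- t + 1 + gap, not after len.  The sentinel gap ℓ (none) means there is no such time; it is
    -- harmless because the robber never hides deeper than ℓ.
    record Sighting : Set where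
      constructor sighting
      field
        gap  : ℕ
        path : ℕ
    open Sighting

    later : Sighting → Sighting
    later (sighting g r) = sighting (suc g) r

    seen : ℕ → Sighting
    seen t = sighting 0 (root (pos t))

    none : Sighting
    none = sighting ℓ 0

    lastDeep : ℕ → Sighting
    lastDeep zero with deep? 0
    ... | yes _ = seen 0
    ... | no _ = none
    lastDeep (suc t) with deep? (suc t)
    ... | yes _ = seen (suc t)
    ... | no _ = later (lastDeep t)

    nextDeepWithin : ℕ → ℕ → Sighting
    nextDeepWithin zero t = none
    nextDeepWithin (suc n) t with deep? (suc t)
    ... | yes _ = seen (suc t)
    ... | no _ = later (nextDeepWithin n (suc t))

    nextDeep : ℕ → Sighting
    nextDeep t = nextDeepWithin (len ∸ t) t

    lastDeep-spec : ∀ t → gap (lastDeep t) < ℓ →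
                    ∃[ s ] (gap (lastDeep t) + s ≡ t × Deep s × path (lastDeep t) ≡ root (pos s))
    lastDeep-spec zero g<ℓ with deep? 0
    ... | yes deep = 0 , refl , deep , refl
    ... | no _ = ⊥-elim (<-irrefl refl g<ℓ)
    lastDeep-spec (suc t) g<ℓ with deep? (suc t)
    ... | yes deep = suc t , refl , deep , refl
    ... | no _ with lastDeep-spec t (<⇒≤ g<ℓ)
    ...   | s , g+s≡t , deep , on-path = s , cong suc g+s≡t , deep , on-path

    nextDeepWithin-spec : ∀ n t → n + t ≡ len → gap (nextDeepWithin n t) < ℓ →
                          ∃[ s ] (suc (gap (nextDeepWithin n t) + t) ≡ s × s ≤ len × Deep s ×
                                  path (nextDeepWithin n t) ≡ root (pos s))
    nextDeepWithin-spec zero t _ g<ℓ = ⊥-elim (<-irrefl refl g<ℓ)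
    nextDeepWithin-spec (suc n) t n+t≡len g<ℓ with deep? (suc t)
    ... | yes deep = suc t , refl , subst (suc t ≤_) n+t≡len (s≤s (m≤n+m t n)) , deep , refl
    ... | no _ with nextDeepWithin-spec n (suc t) (trans (+-suc n t) n+t≡len) (<⇒≤ g<ℓ)
    ...   | s , eq , s≤len , deep , on-path =
            s , trans (cong suc (sym (+-suc (gap (nextDeepWithin n (suc t))) t))) eq , s≤len , deep , on-path

    nextDeep-spec : ∀ {t} → t ≤ len → gap (nextDeep t) < ℓ →
                    ∃[ s ] (suc (gap (nextDeep t) + t) ≡ s × s ≤ len × Deep s × path (nextDeep t) ≡ root (pos s))
    nextDeep-spec {t} t≤len = nextDeepWithin-spec (len ∸ t) t (m∸n+n≡m t≤len)

    lastDeep-deep : ∀ t → Deep t → gap (lastDeep t) ≡ 0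
    lastDeep-deep zero deep with deep? 0
    ... | yes _ = refl
    ... | no shallow = ⊥-elim (shallow deep)
    lastDeep-deep (suc t) deep with deep? (suc t)
    ... | yes _ = refl
    ... | no shallow = ⊥-elim (shallow deep)

    lastDeep-shallow : ∀ t → ¬ Deep (suc t) → lastDeep (suc t) ≡ later (lastDeep t)
    lastDeep-shallow t shallow with deep? (suc t)
    ... | yes deep = ⊥-elim (shallow deep)
    ... | no _ = refl

    nextDeep-deep : ∀ {t} → t < len → Deep (suc t) → gap (nextDeep t) ≡ 0
    nextDeep-deep {t} t<len deep rewrite ∸-suc t<len with deep? (suc t)
    ... | yes _ = refl
    ... | no shallow = ⊥-elim (shallow deep)

    nextDeep-shallow : ∀ {t} → t < len → ¬ Deep (suc t) → nextDeep t ≡ later (nextDeep (suc t))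
    nextDeep-shallow {t} t<len shallow rewrite ∸-suc t<len with deep? (suc t)
    ... | yes deep = ⊥-elim (shallow deep)
    ... | no _ = refl

    hideout : ℕ → Fin 3
    hideout t = proj₁ (avoid (path (lastDeep t)) (path (nextDeep t)))

    hideDepth : ℕ → ℕ
    hideDepth t = ℓ ⊓ gap (lastDeep t) ⊓ gap (nextDeep t)

    hide : ℕ → V
    hide t = onPath (hideout t) (hideDepth t)

    hideDepth≤ℓ : ∀ t → hideDepth t ≤ ℓ
    hideDepth≤ℓ t = ≤-trans (m⊓n≤m _ _) (m⊓n≤m _ _)

    depth-hide : ∀ t → depth (hide t) ≡ hideDepth t
    depth-hide t = depth-onPath (hideout t) (hideDepth≤ℓ t)

    hide-off-last : ∀ t → root (hide t) ≢ path (lastDeep t)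
    hide-off-last t eq = proj₁ (proj₂ (avoid (path (lastDeep t)) (path (nextDeep t)))) (trans (sym (root-onPath (hideout t) (hideDepth t))) eq)

    hide-off-next : ∀ t → root (hide t) ≢ path (nextDeep t)
    hide-off-next t eq = proj₂ (proj₂ (avoid (path (lastDeep t)) (path (nextDeep t)))) (trans (sym (root-onPath (hideout t) (hideDepth t))) eq)

    hide-step-deep : ∀ {t} → t < len → Deep (suc t) → Step Triod (hide t) (hide (suc t))
    hide-step-deep {t} t<len deep =
      subst₂ (λ d d′ → Step Triod (onPath (hideout t) d) (onPath (hideout (suc t)) d′))
        (sym (trans (cong (ℓ ⊓ gap (lastDeep t) ⊓_) (nextDeep-deep t<len deep)) (⊓-zeroʳ _)))
        (sym (cong (λ g → ℓ ⊓ g ⊓ gap (nextDeep (suc t))) (lastDeep-deep (suc t) deep)))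
        (clique-step _ _)

    hide-step-shallow : ∀ {t} → t < len → ¬ Deep (suc t) → Step Triod (hide t) (hide (suc t))
    hide-step-shallow {t} t<len shallow =
      subst (λ z → Step Triod (hide t) (onPath z (hideDepth (suc t)))) same-hideout
        (onPath-step (hideout t) (hideDepth≤ℓ t) (hideDepth≤ℓ (suc t)) close)
      where
      last : lastDeep (suc t) ≡ later (lastDeep t)
      last = lastDeep-shallow t shallow
      next : nextDeep t ≡ later (nextDeep (suc t))
      next = nextDeep-shallow t<len shallow
      same-hideout : hideout t ≡ hideout (suc t)
      same-hideout = cong₂ (λ x y → proj₁ (avoid (path x) (path y))) (sym last) next
      close : ∣ hideDepth t - hideDepth (suc t) ∣ ≤ 1
      close = subst₂ (λ x y → ∣ ℓ ⊓ gap (lastDeep t) ⊓ gap x - ℓ ⊓ gap y ⊓ gap (nextDeep (suc t)) ∣ ≤ 1)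
                (sym next) (sym last) (∣l⊓a⊓1+b-l⊓1+a⊓b∣≤1 ℓ (gap (lastDeep t)) (gap (nextDeep (suc t))))

    hide-step : ∀ t → t < len → Step Triod (hide t) (hide (suc t))
    hide-step t t<len = [ hide-step-deep t<len , hide-step-shallow t<len ]′ (toSum (deep? (suc t)))

    safe-at-leaf : ∀ {t τ} → t ≤ τ → τ ≤ suc t → τ ≤ len →
                   hideDepth t ≡ ℓ → ℓ ≤ gap (lastDeep t) → ℓ ≤ gap (nextDeep t) → ρ < dist (pos τ) (hide t)
    safe-at-leaf {t} {τ} t≤τ τ≤1+t τ≤len at-leaf ℓ≤a ℓ≤b =
      leaf-far room (≮⇒≥ cop-shallow) (trans (depth-hide t) at-leaf)
      where
      ℓ≤⇒≢0 : ∀ {g} → ℓ ≤ g → g ≢ 0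
      ℓ≤⇒≢0 ℓ≤g g≡0 = <⇒≱ (s≤s z≤n) (subst (ℓ ≤_) g≡0 ℓ≤g)
      cop-shallow : ¬ Deep τ
      cop-shallow deep with m≤n⇒m<n∨m≡n τ≤1+t
      ... | inj₁ τ<1+t = ℓ≤⇒≢0 ℓ≤a (lastDeep-deep t (subst Deep (≤-antisym (≤-pred τ<1+t) t≤τ) deep))
      ... | inj₂ refl = ℓ≤⇒≢0 ℓ≤b (nextDeep-deep τ≤len deep)

    safe-after-deep : ∀ {t τ} → t ≤ τ → τ ≤ suc t → τ ≤ len →
                      hideDepth t ≡ gap (lastDeep t) → gap (lastDeep t) < ℓ → ρ < dist (pos τ) (hide t)
    safe-after-deep {t} {τ} t≤τ τ≤1+t τ≤len at-a a<ℓ with lastDeep-spec t a<ℓ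
    ... | s , a+s≡t , deep , on-path =
          far-from-deep (hide t) (within-sym Triod adj-sym (patrol-within Triod p s≤τ τ≤len)) deep
            (λ eq → hide-off-last t (trans (sym eq) (sym on-path))) gap-bound
      where
      a : ℕ
      a = gap (lastDeep t)
      s≤τ : s ≤ τ
      s≤τ = ≤-trans (≤-trans (m≤n+m s a) (≤-reflexive a+s≡t)) t≤τ
      gap-bound : τ ∸ s ≤ suc (depth (hide t))
      gap-bound = begin
        τ ∸ s                 ≤⟨ ∸-monoˡ-≤ s τ≤1+t ⟩
        suc t ∸ s             ≡⟨ cong (λ x → suc x ∸ s) (sym a+s≡t) ⟩
        suc a + s ∸ s         ≡⟨ m+n∸n≡m (suc a) s ⟩
        suc a                 ≡⟨ cong suc (sym (trans (depth-hide t) at-a)) ⟩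
        suc (depth (hide t))  ∎
        where open ≤-Reasoning

    safe-before-deep : ∀ {t τ} → t ≤ τ → τ ≤ suc t → τ ≤ len →
                       hideDepth t ≡ gap (nextDeep t) → gap (nextDeep t) < ℓ → ρ < dist (pos τ) (hide t)
    safe-before-deep {t} {τ} t≤τ τ≤1+t τ≤len at-b b<ℓ with nextDeep-spec (≤-trans t≤τ τ≤len) b<ℓ
    ... | s , 1+b+t≡s , s≤len , deep , on-path =
          far-from-deep (hide t) (patrol-within Triod p τ≤s s≤len) deep
            (λ eq → hide-off-next t (trans (sym eq) (sym on-path))) gap-bound
      where
      b : ℕ
      b = gap (nextDeep t)
      τ≤s : τ ≤ s
      τ≤s = ≤-trans τ≤1+t (≤-trans (s≤s (m≤n+m t b)) (≤-reflexive 1+b+t≡s))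
      gap-bound : s ∸ τ ≤ suc (depth (hide t))
      gap-bound = begin
        s ∸ τ                 ≤⟨ ∸-monoʳ-≤ s t≤τ ⟩
        s ∸ t                 ≡⟨ cong (_∸ t) (sym 1+b+t≡s) ⟩
        suc b + t ∸ t         ≡⟨ m+n∸n≡m (suc b) t ⟩
        suc b                 ≡⟨ cong suc (sym (trans (depth-hide t) at-b)) ⟩
        suc (depth (hide t))  ∎
        where open ≤-Reasoning

    hide-safe : ∀ {t τ} → t ≤ τ → τ ≤ suc t → τ ≤ len → ρ < dist (pos τ) (hide t)
    hide-safe {t} t≤τ τ≤1+t τ≤len with ⊓-cases₃ ℓ (gap (lastDeep t)) (gap (nextDeep t))
    ... | inj₁ (at-leaf , ℓ≤a , ℓ≤b) = safe-at-leaf t≤τ τ≤1+t τ≤len at-leaf ℓ≤a ℓ≤b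
    ... | inj₂ (inj₁ (at-a , a<ℓ)) = safe-after-deep t≤τ τ≤1+t τ≤len at-a a<ℓ
    ... | inj₂ (inj₂ (at-b , b<ℓ)) = safe-before-deep t≤τ τ≤1+t τ≤len at-b b<ℓ

    robber : Robber Triod
    robber = haltAt Triod len hide hide-step

    escapes : ¬ Captures Triod ρ p robber
    escapes (inj₁ (t , t≤len , w)) =
      <⇒≱ (hide-safe ≤-refl (n≤1+n t) t≤len)
          (within⇒dist≤ (subst (Within Triod ρ (pos t)) (haltAt-rpos Triod len hide hide-step t≤len) w))
    escapes (inj₂ (t , t<len , w)) =
      <⇒≱ (hide-safe (n≤1+n t) ≤-refl t<len)
          (within⇒dist≤ (subst (Within Triod ρ (pos (suc t))) (haltAt-rpos Triod len hide hide-step (<⇒≤ t<len)) w))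

  robberWins : ∀ ρ → ρ < ⌈ ℓ /2⌉ → ¬ CopWins Triod ρ
  robberWins ρ ρ<k (p , catches) = Evasion.escapes ρ room p (catches (Evasion.robber ρ room p))
    where
    room : ρ + suc ρ ≤ ℓ
    room = m<⌈n/2⌉⇒m+[1+m]≤n ρ<k

theorem6 : ∀ (m ℓ : ℕ) → 0 < ℓ → RadiusIs (CliqueTriod m ℓ) ⌈ ℓ /2⌉
theorem6 m (suc ℓ′) _ = UpperBound.copWins m ℓ′ , LowerBound.robberWins m ℓ′
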